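{- Let $G$ be a finite, undirected, simple graph and let $\mathbb{R}$ be a $[0,2]$-factor of $G$. Then $\mathbb{R}$ is maximum (i.e. $T_S(\mathbb{R})\le T_S(\mathbb{R}')$ for every $[0,2]$-factor $\mathbb{R}'$ of $G$) if and only if there is no P-chain with respect to $\mathbb{R}$ in $G$.
   Context: A $[0,2]$-factor of $G$ is a spanning subgraph $\mathbb{R}$ of $G$ with $0\le d_{\mathbb{R}}(x)\le 2$ for all $x\in V(G)$, where $d_{\mathbb{R}}(x)$ is the degree of $x$ in $\mathbb{R}$; its characteristic number is $T_S(\mathbb{R})=\sum_{v\in V(G)}(2-d_{\mathbb{R}}(v))$. A P-chain with respect to $\mathbb{R}$ is a sequence of vertices $x_1,x_2,\dots,x_{k+1}$ of $G$ together with edges $e_i=(x_i,x_{i+1})\in E(G)$, $i=1,\dots,k$, which are pairwise distinct (vertices may repeat), such that: $k$ is odd (the case $k=1$ is allowed); $e_j\in E(G)\setminus E(\mathbb{R})$ for odd $j$ and $e_j\in E(\mathbb{R})$ for even $j$; and either $x_1\ne x_{k+1}$ with $d_{\mathbb{R}}(x_1)\le 1$ and $d_{\mathbb{R}}(x_{k+1})\le 1$, or $x_1=x_{k+1}$ with $d_{\mathbb{R}}(x_1)=0$. -}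

module Defs where

open import Data.Nat using (ℕ; zero; suc; _+_; _*_; _∸_; _≤_; _%_)
open import Data.Fin using (Fin; toℕ; inject₁; fromℕ) renaming (zero to fzero; suc to fsuc)
open import Data.List using (List; map; allFin)
open import Data.Nat.ListAction using (sum)
open import Data.Bool using (Bool; true; false; if_then_else_)
open import Data.Product using (Σ; ∃; _×_)
open import Data.Sum using (_⊎_)
open import Relation.Nullary using (¬_)
open import Relation.Binary.PropositionalEquality using (_≡_; _≢_)

record Graph (n : ℕ) : Set where
  field
    adj    : Fin n → Fin n → Bool
    sym    : ∀ i j → adj i j ≡ adj j i
    irrefl : ∀ i → adj i i ≡ false
open Graph public

deg : ∀ {n} → Graph n → Fin n → ℕ
deg {n} H x = sum (map (λ y → if adj H x y then 1 else 0) (allFin n))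

SpanningSubgraph : ∀ {n} → Graph n → Graph n → Set
SpanningSubgraph G R = ∀ x y → adj R x y ≡ true → adj G x y ≡ true

Factor02 : ∀ {n} → Graph n → Graph n → Set
Factor02 G R = SpanningSubgraph G R × (∀ x → deg R x ≤ 2)

-- characteristic number T_S(R) = Σ_v (2 - d_R(v))
-- (natural subtraction is exact here since d_R(v) ≤ 2 for a [0,2]-factor)
TS : ∀ {n} → Graph n → ℕ
TS {n} R = sum (map (λ v → 2 ∸ deg R v) (allFin n))

Maximum : ∀ {n} → Graph n → Graph n → Set
Maximum G R = ∀ R' → Factor02 G R' → TS R ≤ TS R'

-- Vertices x_1..x_{k+1} are x 0 .. x k (0-based); edge e_{i+1} (0-based i : Fin k)
-- joins x (inject₁ i) and x (fsuc i).  1-based odd index = 0-based even index.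
record PChain {n : ℕ} (G R : Graph n) : Set where
  field
    k        : ℕ
    k-odd    : ∃ λ m → k ≡ suc (m * 2)
    x        : Fin (suc k) → Fin n
    inG      : ∀ (i : Fin k) → adj G (x (inject₁ i)) (x (fsuc i)) ≡ true
    notInR   : ∀ (i : Fin k) → toℕ i % 2 ≡ 0 → adj R (x (inject₁ i)) (x (fsuc i)) ≡ false
    inR      : ∀ (i : Fin k) → toℕ i % 2 ≡ 1 → adj R (x (inject₁ i)) (x (fsuc i)) ≡ true
    distinct : ∀ (i j : Fin k) → i ≢ j →
                 ¬ (x (inject₁ i) ≡ x (inject₁ j) × x (fsuc i) ≡ x (fsuc j)) ×
                 ¬ (x (inject₁ i) ≡ x (fsuc j) × x (fsuc i) ≡ x (inject₁ j))
    ends     : (x fzero ≢ x (fromℕ k) × deg R (x fzero) ≤ 1 × deg R (x (fromℕ k)) ≤ 1)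
               ⊎ (x fzero ≡ x (fromℕ k) × deg R (x fzero) ≡ 0)

module Submission where

-- Since T_S(R) = 2n − totalDeg R for a [0,2]-factor, R is maximum iff no [0,2]-factor has
-- larger total degree.  Both directions are statements about toggling R along a trail:
--  * a trail x 0, …, x m is handled as a function ℕ → Fin n; `Trail.count-usedBy` counts the
--    trail edges at a vertex, and the alternating telescope shows that toggling a graph along
--    an alternating trail only changes degrees at the two ends (`toggle-odd-degree`,
--    `toggle-even-degree`);
--  * sufficiency (`chain-augments`): toggling R along a P-chain gives a [0,2]-factor with two
--    more units of degree, the end conditions of the chain keeping all degrees ≤ 2;
--  * necessity (`augmenting-chain`): for a [0,2]-factor R' with more edges, grow from a vertex
--    where R' has larger degree an alternating trail of added/removed edges (module Augment).
--    It gets stuck either after an added edge, and then it is a P-chain, or after a removed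
--    edge, and then toggling R' along it yields a factor of the same size closer to R; the
--    process is repeated, the distance to R decreasing each time.

open import Defs hiding (sym)
open import Function using (_∘_)
open import Function.Bundles using (_⇔_; mk⇔)
open import Data.Nat using (ℕ; zero; suc; _+_; _*_; _∸_; _%_; _≤_; _<_; z≤n; s≤s; _≤?_; _<?_)
open import Data.Nat.Properties
  using ( +-0-commutativeMonoid; +-*-semiring; module ≤-Reasoning
        ; +-comm; +-assoc; +-suc; +-identityʳ; *-comm; *-identityˡ; *-identityʳ; m∸n+n≡m
        ; ≤-refl; ≤-reflexive; ≤-trans; ≤-pred; <⇒≤; <⇒≢; <⇒≱; ≮⇒≥; ≰⇒>; <-≤-trans; n≤0⇒n≡0; n≢0⇒n>0
        ; n<1+n; m<n⇒m<1+n; m<1+n⇒m<n∨m≡n; m≤m+n; m<m+n; m≤m*n; m+n≤o⇒m≤o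
        ; +-mono-≤; +-mono-<-≤; +-mono-≤-<; +-monoˡ-≤; +-monoʳ-≤; +-monoʳ-<
        ; +-cancelʳ-≡; +-cancelʳ-≤; +-cancelʳ-< )
  renaming (_≟_ to _≟ℕ_)
open import Data.Nat.ListAction using (sum)
open import Data.Nat.Tactic.RingSolver using (solve-∀)
open import Data.Fin using (Fin; toℕ; inject₁; fromℕ; fromℕ<) renaming (zero to fzero; suc to fsuc)
open import Data.Fin.Properties using (_≟_; any?; toℕ-inject₁; toℕ-fromℕ<; toℕ-fromℕ; toℕ<n; toℕ-injective)
open import Data.List using (map; allFin; tabulate)
open import Data.List.Properties using (map-tabulate)
open import Data.Bool using (Bool; true; false; if_then_else_; not; _∧_; _∨_; _xor_)
open import Data.Bool.Properties
  using (not-involutive; ∨-comm; ¬-not; ∧-distribʳ-∨; ∧-zeroʳ; ∧-identityʳ; xor-identityʳ)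
  renaming (_≟_ to _≟𝔹_)
open import Data.Product using (_×_; _,_; proj₁; proj₂; ∃-syntax)
open import Data.Sum using (_⊎_; inj₁; inj₂; [_,_])
open import Data.Empty using (⊥; ⊥-elim)
open import Relation.Nullary using (¬_; Dec; yes; no; _×-dec_; _⊎-dec_)
open import Relation.Nullary.Decidable using (does; dec-true; dec-false)
open import Relation.Binary.PropositionalEquality
  using (_≡_; _≢_; refl; sym; trans; cong; cong₂; subst; module ≡-Reasoning)
open import Algebra.Properties.CommutativeMonoid.Sum +-0-commutativeMonoid
  using (sum-cong-≗; ∑-distrib-+; sum-replicate-zero) renaming (sum to ∑)
open import Algebra.Properties.Semiring.Sum +-*-semiring using (*-distribˡ-sum)

ind : Bool → ℕ
ind b = if b then 1 else 0

sum-tabulate : ∀ {n} (f : Fin n → ℕ) → sum (tabulate f) ≡ ∑ f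
sum-tabulate {zero}  f = refl
sum-tabulate {suc n} f = cong (f fzero +_) (sum-tabulate (λ i → f (fsuc i)))

sum-allFin : ∀ {n} (f : Fin n → ℕ) → sum (map f (allFin n)) ≡ ∑ f
sum-allFin {n} f = trans (cong sum (map-tabulate (λ i → i) f)) (sum-tabulate f)

deg-∑ : ∀ {n} (H : Graph n) x → deg H x ≡ ∑ (λ y → ind (adj H x y))
deg-∑ H x = sum-allFin (λ y → ind (adj H x y))

TS-∑ : ∀ {n} (H : Graph n) → TS H ≡ ∑ (λ v → 2 ∸ deg H v)
TS-∑ H = sum-allFin (λ v → 2 ∸ deg H v)

∑-mono : ∀ {n} {f g : Fin n → ℕ} → (∀ i → f i ≤ g i) → ∑ f ≤ ∑ g
∑-mono {zero}  le = z≤n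
∑-mono {suc n} le = +-mono-≤ (le fzero) (∑-mono (λ i → le (fsuc i)))

∑-mono-< : ∀ {n} {f g : Fin n → ℕ} → (∀ i → f i ≤ g i) → ∀ j → f j < g j → ∑ f < ∑ g
∑-mono-< {suc n} le fzero     lt = +-mono-<-≤ lt (∑-mono (λ i → le (fsuc i)))
∑-mono-< {suc n} le (fsuc j) lt = +-mono-≤-< (le fzero) (∑-mono-< (λ i → le (fsuc i)) j lt)

∑-scale : ∀ {n} c (f : Fin n → ℕ) → ∑ (λ i → c * f i) ≡ c * ∑ f
∑-scale c f = sym (*-distribˡ-sum c f)

does-sound : ∀ {A : Set} (d : Dec A) → does d ≡ true → A
does-sound (yes a) _ = a

_≟ᵇ_ : ∀ {n} → Fin n → Fin n → Bool
a ≟ᵇ b = does (a ≟ b)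

≟ᵇ-refl : ∀ {n} (a : Fin n) → (a ≟ᵇ a) ≡ true
≟ᵇ-refl a = dec-true (a ≟ a) refl

≟ᵇ-≢ : ∀ {n} {a b : Fin n} → a ≢ b → (a ≟ᵇ b) ≡ false
≟ᵇ-≢ {a = a} {b} a≢b = dec-false (a ≟ b) a≢b

≟ᵇ-sound : ∀ {n} {a b : Fin n} → (a ≟ᵇ b) ≡ true → a ≡ b
≟ᵇ-sound {a = a} {b} = does-sound (a ≟ b)

∑-point : ∀ {n} (c : Fin n) → ∑ (λ y → ind (c ≟ᵇ y)) ≡ 1
∑-point {suc n} fzero    = cong suc (sum-replicate-zero n)
∑-point {suc n} (fsuc c) = ∑-point c

∑-shift : ∀ {n} (f g : Fin n → ℕ) (a b : Fin n) →
          (∀ v → f v + ind (a ≟ᵇ v) ≡ g v + ind (b ≟ᵇ v)) → ∑ f ≡ ∑ g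
∑-shift f g a b eq = +-cancelʳ-≡ 1 (∑ f) (∑ g) (begin
  ∑ f + 1                                   ≡⟨ cong (∑ f +_) (sym (∑-point a)) ⟩
  ∑ f + ∑ (λ v → ind (a ≟ᵇ v))              ≡⟨ sym (∑-distrib-+ f _) ⟩
  ∑ (λ v → f v + ind (a ≟ᵇ v))              ≡⟨ sum-cong-≗ eq ⟩
  ∑ (λ v → g v + ind (b ≟ᵇ v))              ≡⟨ ∑-distrib-+ g _ ⟩
  ∑ g + ∑ (λ v → ind (b ≟ᵇ v))              ≡⟨ cong (∑ g +_) (∑-point b) ⟩
  ∑ g + 1                                   ∎)
  where open ≡-Reasoning

anyBelow : ℕ → (ℕ → Bool) → Bool
anyBelow zero    p = false
anyBelow (suc m) p = anyBelow m p ∨ p m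

sumBelow : ℕ → (ℕ → ℕ) → ℕ
sumBelow zero    f = 0
sumBelow (suc m) f = sumBelow m f + f m

anyBelow-witness : ∀ m p → anyBelow m p ≡ true → ∃[ i ] (i < m × p i ≡ true)
anyBelow-witness (suc m) p eq with anyBelow m p in below | p m in last
... | true  | _    = let (i , i<m , pi) = anyBelow-witness m p below in i , m<n⇒m<1+n i<m , pi
... | false | true = m , ≤-refl , last

anyBelow-intro : ∀ m p i → i < m → p i ≡ true → anyBelow m p ≡ true
anyBelow-intro (suc m) p i i<1+m pi with m<1+n⇒m<n∨m≡n i<1+m
... | inj₁ i<m  = cong (_∨ p m) (anyBelow-intro m p i i<m pi)
... | inj₂ refl = trans (cong (anyBelow m p ∨_) pi) (∨-comm _ true)

anyBelow-none : ∀ m p → anyBelow m p ≡ false → ∀ i → i < m → p i ≡ false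
anyBelow-none m p none i i<m with p i in pi
... | false = refl
... | true  = trans (sym (anyBelow-intro m p i i<m pi)) none

anyBelow-cong : ∀ m p q → (∀ i → i < m → p i ≡ q i) → anyBelow m p ≡ anyBelow m q
anyBelow-cong zero    p q eq = refl
anyBelow-cong (suc m) p q eq =
  cong₂ _∨_ (anyBelow-cong m p q (λ i i<m → eq i (m<n⇒m<1+n i<m))) (eq m ≤-refl)

sumBelow-cong : ∀ m f g → (∀ i → i < m → f i ≡ g i) → sumBelow m f ≡ sumBelow m g
sumBelow-cong zero    f g eq = refl
sumBelow-cong (suc m) f g eq =
  cong₂ _+_ (sumBelow-cong m f g (λ i i<m → eq i (m<n⇒m<1+n i<m))) (eq m ≤-refl)

sumBelow-const : ∀ m c → sumBelow m (λ _ → c) ≡ m * c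
sumBelow-const zero    c = refl
sumBelow-const (suc m) c = trans (cong (_+ c) (sumBelow-const m c)) (+-comm (m * c) c)

∑-sumBelow : ∀ {n} m (f : Fin n → ℕ → ℕ) → ∑ (λ v → sumBelow m (f v)) ≡ sumBelow m (λ i → ∑ (λ v → f v i))
∑-sumBelow {n} zero    f = sum-replicate-zero n
∑-sumBelow     (suc m) f = trans (∑-distrib-+ (λ v → sumBelow m (f v)) (λ v → f v m))
                                 (cong (_+ ∑ (λ v → f v m)) (∑-sumBelow m f))

isEven : ℕ → Bool
isEven zero    = true
isEven (suc i) = not (isEven i)

isOdd : ℕ → Bool
isOdd i = not (isEven i)

%2≡isOdd : ∀ i → i % 2 ≡ ind (isOdd i)
%2≡isOdd zero          = refl
%2≡isOdd (suc zero)    = refl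
%2≡isOdd (suc (suc i)) = trans (%2≡isOdd i) (cong (ind ∘ not) (sym (not-involutive (isEven i))))

isEven-oddForm : ∀ j → isEven (suc (j * 2)) ≡ false
isEven-oddForm zero    = refl
isEven-oddForm (suc j) = trans (not-involutive (isEven (suc (j * 2)))) (isEven-oddForm j)

oddForm : ∀ m → isEven m ≡ false → ∃[ j ] (m ≡ suc (j * 2))
oddForm (suc zero)    _   = 0 , refl
oddForm (suc (suc m)) odd with oddForm m (trans (sym (not-involutive (isEven m))) odd)
... | j , refl = suc j , refl

stepSum : ℕ → (ℕ → Bool) → (ℕ → ℕ) → ℕ
stepSum m P f = sumBelow m (λ i → ind (P i) * (f i + f (suc i)))

-- Alternating telescoping: the positions of a path of length m are covered by the
-- even steps plus (if m is even) the last position, and by the odd steps plus the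
-- first position plus (if m is odd) the last position.
alternating-telescope : ∀ (f : ℕ → ℕ) m →
  stepSum m isEven f + ind (isEven m) * f m ≡ stepSum m isOdd f + (f 0 + ind (isOdd m) * f m)
alternating-telescope f zero = refl
alternating-telescope f (suc m) with isEven m | alternating-telescope f m
... | true | ih = begin
    E + (a + b + 0) + 0      ≡⟨ rearrangeˡ E a b ⟩
    (E + (a + 0)) + b        ≡⟨ cong (_+ b) ih ⟩
    (O + (f 0 + 0)) + b      ≡⟨ rearrangeʳ O (f 0) b ⟩
    O + 0 + (f 0 + (b + 0))  ∎
  where
    open ≡-Reasoning
    E = stepSum m isEven f ; O = stepSum m isOdd f ; a = f m ; b = f (suc m)
    rearrangeˡ : ∀ E a b → E + (a + b + 0) + 0 ≡ (E + (a + 0)) + b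
    rearrangeˡ = solve-∀
    rearrangeʳ : ∀ O c b → (O + (c + 0)) + b ≡ O + 0 + (c + (b + 0))
    rearrangeʳ = solve-∀
... | false | ih = begin
    E + 0 + (b + 0)               ≡⟨ rearrangeˡ E b ⟩
    (E + 0) + b                   ≡⟨ cong (_+ b) ih ⟩
    (O + (f 0 + (a + 0))) + b     ≡⟨ rearrangeʳ O (f 0) a b ⟩
    O + (a + b + 0) + (f 0 + 0)   ∎
  where
    open ≡-Reasoning
    E = stepSum m isEven f ; O = stepSum m isOdd f ; a = f m ; b = f (suc m)
    rearrangeˡ : ∀ E b → E + 0 + (b + 0) ≡ (E + 0) + b
    rearrangeˡ = solve-∀
    rearrangeʳ : ∀ O c a b → (O + (c + (a + 0))) + b ≡ O + (a + b + 0) + (c + 0)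
    rearrangeʳ = solve-∀

∧-true : ∀ {a b} → (a ∧ b) ≡ true → a ≡ true × b ≡ true
∧-true {true} {true} _ = refl , refl

∧-intro : ∀ {a b} → a ≡ true → b ≡ true → (a ∧ b) ≡ true
∧-intro refl refl = refl

∧-not-false : ∀ {a b} → (a ∧ not b) ≡ false → a ≡ true → b ≡ true
∧-not-false {true} {true} _ _ = refl

not-true : ∀ {b} → not b ≡ true → b ≡ false
not-true {false} _ = refl

ind-∧ : ∀ a b → ind (a ∧ b) ≡ ind a * ind b
ind-∧ true  b = sym (+-identityʳ (ind b))
ind-∧ false b = refl

ind-∨-disjoint : ∀ a b → (a ≡ true → b ≡ true → ⊥) → ind (a ∨ b) ≡ ind a + ind b
ind-∨-disjoint true  true  disj = ⊥-elim (disj refl refl)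
ind-∨-disjoint true  false disj = refl
ind-∨-disjoint false b     disj = refl

ind-mono : ∀ {a b} → (a ≡ true → b ≡ true) → ind a ≤ ind b
ind-mono {false} _   = z≤n
ind-mono {true}  a⇒b rewrite a⇒b refl = ≤-refl

count-mono : ∀ {n} {a b : Fin n → Bool} → (∀ y → a y ≡ true → b y ≡ true) → ∑ (ind ∘ a) ≤ ∑ (ind ∘ b)
count-mono a⇒b = ∑-mono (λ y → ind-mono (a⇒b y))

SamePair : ∀ {n} → Fin n → Fin n → Fin n → Fin n → Set
SamePair a b c d = (a ≡ c × b ≡ d) ⊎ (a ≡ d × b ≡ c)

samePair? : ∀ {n} (a b c d : Fin n) → Dec (SamePair a b c d)
samePair? a b c d = (a ≟ c ×-dec b ≟ d) ⊎-dec (a ≟ d ×-dec b ≟ c)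

samePair-via : ∀ {n} {a b c d v y : Fin n} → SamePair a b v y → SamePair c d v y → SamePair a b c d
samePair-via (inj₁ (refl , refl)) (inj₁ (refl , refl)) = inj₁ (refl , refl)
samePair-via (inj₁ (refl , refl)) (inj₂ (refl , refl)) = inj₂ (refl , refl)
samePair-via (inj₂ (refl , refl)) (inj₁ (refl , refl)) = inj₂ (refl , refl)
samePair-via (inj₂ (refl , refl)) (inj₂ (refl , refl)) = inj₁ (refl , refl)

samePair-sym : ∀ {n} {a b c d : Fin n} → SamePair a b c d → SamePair c d a b
samePair-sym (inj₁ (refl , refl)) = inj₁ (refl , refl)
samePair-sym (inj₂ (refl , refl)) = inj₂ (refl , refl)

samePair-subst : ∀ {n} {a b c d a′ b′ c′ d′ : Fin n} →
                 a ≡ a′ → b ≡ b′ → c ≡ c′ → d ≡ d′ → SamePair a b c d → SamePair a′ b′ c′ d′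
samePair-subst refl refl refl refl p = p

balance-transfer : ∀ a b p q r s → a + p ≡ b + q → q + r ≡ p + s → a + r ≡ b + s
balance-transfer a b p q r s e₁ e₂ = +-cancelʳ-≡ p (a + r) (b + s) (begin
  a + r + p     ≡⟨ +-assoc a r p ⟩
  a + (r + p)   ≡⟨ cong (a +_) (+-comm r p) ⟩
  a + (p + r)   ≡⟨ sym (+-assoc a p r) ⟩
  a + p + r     ≡⟨ cong (_+ r) e₁ ⟩
  b + q + r     ≡⟨ +-assoc b q r ⟩
  b + (q + r)   ≡⟨ cong (b +_) e₂ ⟩
  b + (p + s)   ≡⟨ cong (b +_) (+-comm p s) ⟩
  b + (s + p)   ≡⟨ sym (+-assoc b s p) ⟩
  b + s + p     ∎)
  where open ≡-Reasoning

module Trail {n : ℕ} (x : ℕ → Fin n) where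

  traverses : ℕ → Fin n → Fin n → Bool
  traverses i v y = does (samePair? (x i) (x (suc i)) v y)

  traverses-sym : ∀ i v y → traverses i v y ≡ traverses i y v
  traverses-sym i v y = ∨-comm ((x i ≟ᵇ v) ∧ (x (suc i) ≟ᵇ y)) ((x i ≟ᵇ y) ∧ (x (suc i) ≟ᵇ v))

  traverses-value : (S : Fin n → Fin n → Bool) → (∀ a b → S a b ≡ S b a) →
                    ∀ i v y → traverses i v y ≡ true → S v y ≡ S (x i) (x (suc i))
  traverses-value S S-sym i v y t with does-sound (samePair? (x i) (x (suc i)) v y) t
  ... | inj₁ (refl , refl) = refl
  ... | inj₂ (refl , refl) = S-sym _ _

  usedBy : ℕ → (ℕ → Bool) → Fin n → Fin n → Bool
  usedBy m P v y = anyBelow m (λ i → P i ∧ traverses i v y)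

  onTrail : ℕ → Fin n → Fin n → Bool
  onTrail m = usedBy m (λ _ → true)

  onTrail-sym : ∀ m v y → onTrail m v y ≡ onTrail m y v
  onTrail-sym m v y = anyBelow-cong m _ _ (λ i _ → traverses-sym i v y)

  visits : ℕ → Fin n → ℕ
  visits i v = ind (x i ≟ᵇ v)

  incidences : ℕ → (ℕ → Bool) → Fin n → ℕ
  incidences m P v = stepSum m P (λ i → visits i v)

  incidences-not-odd : ∀ m v → incidences m (not ∘ isOdd) v ≡ incidences m isEven v
  incidences-not-odd m v =
    sumBelow-cong m _ _ (λ i _ → cong (λ b → ind b * (visits i v + visits (suc i) v)) (not-involutive (isEven i)))

  Loopless : ℕ → Set
  Loopless m = ∀ i → i < m → x i ≢ x (suc i)

  EdgeDistinct : ℕ → Set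
  EdgeDistinct m = ∀ i j → i < m → j < m → i ≢ j → ¬ SamePair (x i) (x (suc i)) (x j) (x (suc j))

  Follows : (Fin n → Fin n → Bool) → (ℕ → Bool) → ℕ → Set
  Follows S Q m = ∀ i → i < m → S (x i) (x (suc i)) ≡ Q i

  loopless-within : ∀ m (S : Fin n → Fin n → Bool) → (∀ v → S v v ≡ false) →
                    Follows S (λ _ → true) m → Loopless m
  loopless-within m S S-irrefl steps i i<m loop
    with () ← trans (sym (steps i i<m)) (trans (cong (S (x i)) (sym loop)) (S-irrefl (x i)))

  onTrail-irrefl : ∀ m → Loopless m → ∀ v → onTrail m v v ≡ false
  onTrail-irrefl m loopless v = ¬-not onTrail≢true
    where
      onTrail≢true : onTrail m v v ≢ true
      onTrail≢true t with anyBelow-witness m _ t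
      ... | i , i<m , step with does-sound (samePair? (x i) (x (suc i)) v v) step
      ...   | inj₁ (refl , eq) = loopless i i<m (sym eq)
      ...   | inj₂ (refl , eq) = loopless i i<m (sym eq)

  traverses-count : ∀ i v → x i ≢ x (suc i) →
                    ∑ (λ y → ind (traverses i v y)) ≡ visits i v + visits (suc i) v
  traverses-count i v no-loop = begin
      ∑ (λ y → ind (traverses i v y))
    ≡⟨ sum-cong-≗ (λ y → ind-∨-disjoint (a ∧ b y) (c y ∧ d) (not-both y)) ⟩
      ∑ (λ y → ind (a ∧ b y) + ind (c y ∧ d))
    ≡⟨ sum-cong-≗ (λ y → cong₂ _+_ (ind-∧ a (b y)) (trans (ind-∧ (c y) d) (*-comm (ind (c y)) (ind d)))) ⟩
      ∑ (λ y → ind a * ind (b y) + ind d * ind (c y))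
    ≡⟨ ∑-distrib-+ (λ y → ind a * ind (b y)) (λ y → ind d * ind (c y)) ⟩
      ∑ (λ y → ind a * ind (b y)) + ∑ (λ y → ind d * ind (c y))
    ≡⟨ cong₂ _+_ (trans (∑-scale (ind a) (ind ∘ b)) (cong (ind a *_) (∑-point (x (suc i)))))
                 (trans (∑-scale (ind d) (ind ∘ c)) (cong (ind d *_) (∑-point (x i)))) ⟩
      ind a * 1 + ind d * 1
    ≡⟨ cong₂ _+_ (*-identityʳ (ind a)) (*-identityʳ (ind d)) ⟩
      visits i v + visits (suc i) v
    ∎
    where
      open ≡-Reasoning
      a = x i ≟ᵇ v
      d = x (suc i) ≟ᵇ v
      b c : Fin n → Bool
      b y = x (suc i) ≟ᵇ y
      c y = x i ≟ᵇ y
      not-both : ∀ y → (a ∧ b y) ≡ true → (c y ∧ d) ≡ true → ⊥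
      not-both y ab cd = no-loop (trans (≟ᵇ-sound (proj₁ (∧-true ab))) (sym (≟ᵇ-sound (proj₂ (∧-true {c y} cd)))))

  count-usedBy : ∀ m P v → Loopless m → EdgeDistinct m →
                 ∑ (λ y → ind (usedBy m P v y)) ≡ incidences m P v
  count-usedBy zero    P v _ _ = sum-replicate-zero n
  count-usedBy (suc m) P v loopless distinct = begin
      ∑ (λ y → ind (usedBy m P v y ∨ (P m ∧ traverses m v y)))
    ≡⟨ sum-cong-≗ (λ y → ind-∨-disjoint _ _ (new-edge y)) ⟩
      ∑ (λ y → ind (usedBy m P v y) + ind (P m ∧ traverses m v y))
    ≡⟨ ∑-distrib-+ (λ y → ind (usedBy m P v y)) (λ y → ind (P m ∧ traverses m v y)) ⟩
      ∑ (λ y → ind (usedBy m P v y)) + ∑ (λ y → ind (P m ∧ traverses m v y))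
    ≡⟨ cong₂ _+_ (count-usedBy m P v (λ i i<m → loopless i (m<n⇒m<1+n i<m))
                                     (λ i j i<m j<m → distinct i j (m<n⇒m<1+n i<m) (m<n⇒m<1+n j<m)))
                 (trans (sum-cong-≗ (λ y → ind-∧ (P m) (traverses m v y)))
                 (trans (∑-scale (ind (P m)) (λ y → ind (traverses m v y)))
                        (cong (ind (P m) *_) (traverses-count m v (loopless m ≤-refl))))) ⟩
      incidences (suc m) P v
    ∎
    where
      open ≡-Reasoning
      new-edge : ∀ y → usedBy m P v y ≡ true → (P m ∧ traverses m v y) ≡ true → ⊥
      new-edge y before last with anyBelow-witness m _ before
      ... | i , i<m , step =
        distinct i m (m<n⇒m<1+n i<m) ≤-refl (<⇒≢ i<m)
          (samePair-via (does-sound (samePair? _ _ v y) (proj₂ (∧-true {P i} step)))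
                        (does-sound (samePair? _ _ v y) (proj₂ (∧-true {P m} last))))

  onTrail-∧ : ∀ m (S : Fin n → Fin n → Bool) (Q : ℕ → Bool) → (∀ a b → S a b ≡ S b a) →
              Follows S Q m → ∀ v y → (onTrail m v y ∧ S v y) ≡ usedBy m Q v y
  onTrail-∧ zero    S Q S-sym follows v y = refl
  onTrail-∧ (suc m) S Q S-sym follows v y = begin
      (onTrail m v y ∨ traverses m v y) ∧ S v y
    ≡⟨ ∧-distribʳ-∨ (S v y) (onTrail m v y) (traverses m v y) ⟩
      (onTrail m v y ∧ S v y) ∨ (traverses m v y ∧ S v y)
    ≡⟨ cong₂ _∨_ (onTrail-∧ m S Q S-sym (λ i i<m → follows i (m<n⇒m<1+n i<m)) v y) last-step ⟩
      usedBy m Q v y ∨ (Q m ∧ traverses m v y)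
    ∎
    where
      open ≡-Reasoning
      last-step : (traverses m v y ∧ S v y) ≡ (Q m ∧ traverses m v y)
      last-step with traverses m v y in t
      ... | false = sym (∧-zeroʳ (Q m))
      ... | true  = trans (traverses-value S S-sym m v y t) (trans (follows m ≤-refl) (sym (∧-identityʳ (Q m))))

  onTrail-within : ∀ m (S : Fin n → Fin n → Bool) → (∀ a b → S a b ≡ S b a) →
                   Follows S (λ _ → true) m → ∀ v y → onTrail m v y ≡ true → S v y ≡ true
  onTrail-within m S S-sym steps v y on =
    proj₂ (∧-true (trans (onTrail-∧ m S (λ _ → true) S-sym steps v y) on))

  count-onTrail-∧ : ∀ m (S : Fin n → Fin n → Bool) (Q : ℕ → Bool) → Loopless m → EdgeDistinct m →
                    (∀ a b → S a b ≡ S b a) → Follows S Q m → ∀ v →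
                    ∑ (λ y → ind (onTrail m v y ∧ S v y)) ≡ incidences m Q v
  count-onTrail-∧ m S Q loopless distinct S-sym follows v =
    trans (sum-cong-≗ (λ y → cong ind (onTrail-∧ m S Q S-sym follows v y))) (count-usedBy m Q v loopless distinct)

  count-onTrail-∧-not : ∀ m (S : Fin n → Fin n → Bool) (Q : ℕ → Bool) → Loopless m → EdgeDistinct m →
                        (∀ a b → S a b ≡ S b a) → Follows S Q m → ∀ v →
                        ∑ (λ y → ind (onTrail m v y ∧ not (S v y))) ≡ incidences m (not ∘ Q) v
  count-onTrail-∧-not m S Q loopless distinct S-sym follows =
    count-onTrail-∧ m (λ a b → not (S a b)) (not ∘ Q) loopless distinct
      (λ a b → cong not (S-sym a b)) (λ i i<m → cong not (follows i i<m))

  toggle : Graph n → ∀ m → Loopless m → Graph n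
  toggle S m loopless = record
    { adj    = λ v y → adj S v y xor onTrail m v y
    ; sym    = λ v y → cong₂ _xor_ (Graph.sym S v y) (onTrail-sym m v y)
    ; irrefl = λ v → cong₂ _xor_ (Graph.irrefl S v) (onTrail-irrefl m loopless v) }

  toggle-degree : ∀ m (S : Graph n) (Q : ℕ → Bool) (loopless : Loopless m) → EdgeDistinct m →
                  Follows (adj S) Q m → ∀ v →
                  deg (toggle S m loopless) v + incidences m Q v ≡ deg S v + incidences m (not ∘ Q) v
  toggle-degree m S Q loopless distinct follows v = begin
      deg (toggle S m loopless) v + incidences m Q v
    ≡⟨ cong₂ _+_ (deg-∑ (toggle S m loopless) v) (sym (count-onTrail-∧ m (adj S) Q loopless distinct (Graph.sym S) follows v)) ⟩
      ∑ (λ y → ind (s y xor t y)) + ∑ (λ y → ind (t y ∧ s y))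
    ≡⟨ sym (∑-distrib-+ (λ y → ind (s y xor t y)) (λ y → ind (t y ∧ s y))) ⟩
      ∑ (λ y → ind (s y xor t y) + ind (t y ∧ s y))
    ≡⟨ sum-cong-≗ (λ y → toggle-count (s y) (t y)) ⟩
      ∑ (λ y → ind (s y) + ind (t y ∧ not (s y)))
    ≡⟨ ∑-distrib-+ (λ y → ind (s y)) (λ y → ind (t y ∧ not (s y))) ⟩
      ∑ (λ y → ind (s y)) + ∑ (λ y → ind (t y ∧ not (s y)))
    ≡⟨ cong₂ _+_ (sym (deg-∑ S v)) (count-onTrail-∧-not m (adj S) Q loopless distinct (Graph.sym S) follows v) ⟩
      deg S v + incidences m (not ∘ Q) v
    ∎
    where
      open ≡-Reasoning
      s t : Fin n → Bool
      s = adj S v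
      t = onTrail m v
      toggle-count : ∀ a b → ind (a xor b) + ind (b ∧ a) ≡ ind a + ind (b ∧ not a)
      toggle-count true  true  = refl
      toggle-count true  false = refl
      toggle-count false true  = refl
      toggle-count false false = refl

  -- Toggling an odd alternating trail whose first step is a non-edge of S (the situation
  -- of a P-chain) raises the degree at each of its two ends by one.
  toggle-odd-degree : ∀ m (S : Graph n) (loopless : Loopless m) → EdgeDistinct m →
                      Follows (adj S) isOdd m → isEven m ≡ false → ∀ v →
                      deg (toggle S m loopless) v ≡ deg S v + (visits 0 v + visits m v)
  toggle-odd-degree m S loopless distinct follows odd v = begin
      deg S' v                                             ≡⟨ +-identityʳ (deg S' v) ⟨
      deg S' v + ind false * visits m v                    ≡⟨ cong (λ b → deg S' v + ind b * visits m v) odd ⟨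
      deg S' v + ind (isEven m) * visits m v               ≡⟨ trade ⟩
      deg S v + (visits 0 v + ind (isOdd m) * visits m v)  ≡⟨ cong (λ b → deg S v + (visits 0 v + ind (not b) * visits m v)) odd ⟩
      deg S v + (visits 0 v + (visits m v + 0))            ≡⟨ cong (λ k → deg S v + (visits 0 v + k)) (+-identityʳ (visits m v)) ⟩
      deg S v + (visits 0 v + visits m v)                  ∎
    where
      open ≡-Reasoning
      S' = toggle S m loopless
      trade : deg S' v + ind (isEven m) * visits m v ≡ deg S v + (visits 0 v + ind (isOdd m) * visits m v)
      trade = balance-transfer _ _ (incidences m isOdd v) (incidences m isEven v) _ _
        (trans (toggle-degree m S isOdd loopless distinct follows v) (cong (deg S v +_) (incidences-not-odd m v)))
        (alternating-telescope (λ i → visits i v) m)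

  toggle-even-degree : ∀ m (S : Graph n) (loopless : Loopless m) → EdgeDistinct m →
                       Follows (adj S) isEven m → isEven m ≡ true → ∀ v →
                       deg (toggle S m loopless) v + visits 0 v ≡ deg S v + visits m v
  toggle-even-degree m S loopless distinct follows even v = begin
      deg S' v + visits 0 v                                ≡⟨ cong (λ k → deg S' v + k) (+-identityʳ (visits 0 v)) ⟨
      deg S' v + (visits 0 v + ind false * visits m v)     ≡⟨ cong (λ b → deg S' v + (visits 0 v + ind (not b) * visits m v)) even ⟨
      deg S' v + (visits 0 v + ind (isOdd m) * visits m v) ≡⟨ trade ⟩
      deg S v + ind (isEven m) * visits m v                ≡⟨ cong (λ b → deg S v + ind b * visits m v) even ⟩
      deg S v + (visits m v + 0)                           ≡⟨ cong (deg S v +_) (+-identityʳ (visits m v)) ⟩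
      deg S v + visits m v                                 ∎
    where
      open ≡-Reasoning
      S' = toggle S m loopless
      trade : deg S' v + (visits 0 v + ind (isOdd m) * visits m v) ≡ deg S v + ind (isEven m) * visits m v
      trade = balance-transfer _ _ (incidences m isEven v) (incidences m isOdd v) _ _
        (toggle-degree m S isEven loopless distinct follows v)
        (sym (alternating-telescope (λ i → visits i v) m))

snoc : ∀ {n} → (ℕ → Fin n) → ℕ → Fin n → ℕ → Fin n
snoc x m y j = if does (j ≟ℕ suc m) then y else x j

snoc-old : ∀ {n} (x : ℕ → Fin n) m y {j} → j ≤ m → snoc x m y j ≡ x j
snoc-old x m y {j} j≤m = cong (if_then y else x j) (dec-false (j ≟ℕ suc m) (<⇒≢ (s≤s j≤m)))

snoc-new : ∀ {n} (x : ℕ → Fin n) m y → snoc x m y (suc m) ≡ y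
snoc-new x m y = cong (if_then y else x (suc m)) (dec-true (suc m ≟ℕ suc m) refl)

follows-snoc : ∀ {n} (x : ℕ → Fin n) m y (S : Fin n → Fin n → Bool) (Q : ℕ → Bool) →
               Trail.Follows x S Q m → S (x m) y ≡ Q m → Trail.Follows (snoc x m y) S Q (suc m)
follows-snoc x m y S Q follows last i i<1+m with m<1+n⇒m<n∨m≡n i<1+m
... | inj₁ i<m  = trans (cong₂ S (snoc-old x m y (<⇒≤ i<m)) (snoc-old x m y i<m)) (follows i i<m)
... | inj₂ refl = trans (cong₂ S (snoc-old x m y ≤-refl) (snoc-new x m y)) last

distinct-snoc : ∀ {n} (x : ℕ → Fin n) m y → Trail.EdgeDistinct x m →
                Trail.onTrail x m (x m) y ≡ false → Trail.EdgeDistinct (snoc x m y) (suc m)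
distinct-snoc x m y distinct fresh i j i<1+m j<1+m i≢j same =
  by-position (m<1+n⇒m<n∨m≡n i<1+m) (m<1+n⇒m<n∨m≡n j<1+m) same
  where
    old : ∀ {k} → k ≤ m → snoc x m y k ≡ x k
    old = snoc-old x m y
    unused : ∀ {k} → k < m → ¬ SamePair (x k) (x (suc k)) (x m) y
    unused {k} k<m same-as-new
      with () ← trans (sym (dec-true (samePair? (x k) (x (suc k)) (x m) y) same-as-new))
                      (anyBelow-none m _ fresh k k<m)
    by-position : i < m ⊎ i ≡ m → j < m ⊎ j ≡ m →
                  ¬ SamePair (snoc x m y i) (snoc x m y (suc i)) (snoc x m y j) (snoc x m y (suc j))
    by-position (inj₁ i<m) (inj₁ j<m) p =
      distinct i j i<m j<m i≢j (samePair-subst (old (<⇒≤ i<m)) (old i<m) (old (<⇒≤ j<m)) (old j<m) p)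
    by-position (inj₂ refl) (inj₂ refl) p = i≢j refl
    by-position (inj₁ i<m) (inj₂ refl) p =
      unused i<m (samePair-subst (old (<⇒≤ i<m)) (old i<m) (old ≤-refl) (snoc-new x m y) p)
    by-position (inj₂ refl) (inj₁ j<m) p =
      unused j<m (samePair-sym (samePair-subst (old ≤-refl) (snoc-new x m y) (old (<⇒≤ j<m)) (old j<m) p))

search : ∀ {n} (p : Fin n → Bool) → (∃[ y ] p y ≡ true) ⊎ (∀ y → p y ≡ false)
search p with any? (λ y → p y ≟𝔹 true)
... | yes found = inj₁ found
... | no none   = inj₂ (λ y → ¬-not (λ py → none (y , py)))

totalDeg : ∀ {n} → Graph n → ℕ
totalDeg H = ∑ (deg H)

TS+totalDeg : ∀ {n} {G R : Graph n} → Factor02 G R → TS R + totalDeg R ≡ ∑ (λ (_ : Fin n) → 2)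
TS+totalDeg {n} {R = R} (_ , deg≤2) = begin
  TS R + totalDeg R                          ≡⟨ cong (_+ totalDeg R) (TS-∑ R) ⟩
  ∑ (λ v → 2 ∸ deg R v) + ∑ (deg R)          ≡⟨ ∑-distrib-+ (λ v → 2 ∸ deg R v) (deg R) ⟨
  ∑ (λ v → 2 ∸ deg R v + deg R v)            ≡⟨ sum-cong-≗ (λ v → m∸n+n≡m (deg≤2 v)) ⟩
  ∑ (λ (_ : Fin n) → 2)                      ∎
  where open ≡-Reasoning

TS-antitone : ∀ {n} {G A B : Graph n} → Factor02 G A → Factor02 G B → totalDeg A ≤ totalDeg B → TS B ≤ TS A
TS-antitone {G = G} {A} {B} FA FB le = +-cancelʳ-≤ (totalDeg A) (TS B) (TS A) (begin
  TS B + totalDeg A  ≤⟨ +-monoʳ-≤ (TS B) le ⟩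
  TS B + totalDeg B  ≡⟨ trans (TS+totalDeg {G = G} {B} FB) (sym (TS+totalDeg {G = G} {A} FA)) ⟩
  TS A + totalDeg A  ∎)
  where open ≤-Reasoning

TS-antitone-strict : ∀ {n} {G A B : Graph n} → Factor02 G A → Factor02 G B → totalDeg A < totalDeg B → TS B < TS A
TS-antitone-strict {G = G} {A} {B} FA FB lt = +-cancelʳ-< (totalDeg A) (TS B) (TS A) (begin-strict
  TS B + totalDeg A  <⟨ +-monoʳ-< (TS B) lt ⟩
  TS B + totalDeg B  ≡⟨ trans (TS+totalDeg {G = G} {B} FB) (sym (TS+totalDeg {G = G} {A} FA)) ⟩
  TS A + totalDeg A  ∎)
  where open ≤-Reasoning

raise-ends-≤2 : ∀ {n} (d : Fin n → ℕ) (a b : Fin n) → (∀ v → d v ≤ 2) → d a ≤ 1 → d b ≤ 1 →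
                (a ≡ b → d a ≡ 0) → ∀ v → d v + (ind (a ≟ᵇ v) + ind (b ≟ᵇ v)) ≤ 2
raise-ends-≤2 d a b d≤2 da≤1 db≤1 loop v with a ≟ v | b ≟ v
... | yes refl | yes refl = ≤-reflexive (cong (_+ 2) (loop refl))
... | yes refl | no _     = +-monoˡ-≤ 1 da≤1
... | no _     | yes refl = +-monoˡ-≤ 1 db≤1
... | no _     | no _     = ≤-trans (≤-reflexive (+-identityʳ (d v))) (d≤2 v)

-- Reads a position j of a sequence indexed by Fin (suc k), saturating at the last position k.
clamp : ∀ k → ℕ → Fin (suc k)
clamp k       zero    = fzero
clamp zero    (suc j) = fzero
clamp (suc k) (suc j) = fsuc (clamp k j)

clamp-toℕ : ∀ k (i : Fin (suc k)) → clamp k (toℕ i) ≡ i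
clamp-toℕ k       fzero    = refl
clamp-toℕ (suc k) (fsuc i) = cong fsuc (clamp-toℕ k i)

module ChainToggle {n : ℕ} {G R : Graph n} (FR : Factor02 G R) (chain : PChain G R) where
  open PChain chain

  walk : ℕ → Fin n
  walk j = x (clamp k j)

  open Trail walk

  walk-toℕ : ∀ i → walk (toℕ i) ≡ x i
  walk-toℕ i = cong x (clamp-toℕ k i)

  walk-last : walk k ≡ x (fromℕ k)
  walk-last = trans (cong walk (sym (toℕ-fromℕ k))) (walk-toℕ (fromℕ k))

  step-first : ∀ {i} (i<k : i < k) → walk i ≡ x (inject₁ (fromℕ< i<k))
  step-first i<k = trans (cong walk (sym (trans (toℕ-inject₁ _) (toℕ-fromℕ< i<k)))) (walk-toℕ _)

  step-second : ∀ {i} (i<k : i < k) → walk (suc i) ≡ x (fsuc (fromℕ< i<k))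
  step-second i<k = trans (cong (walk ∘ suc) (sym (toℕ-fromℕ< i<k))) (walk-toℕ (fsuc _))

  step-value : ∀ (S : Fin n → Fin n → Bool) {i} (i<k : i < k) →
               S (walk i) (walk (suc i)) ≡ S (x (inject₁ (fromℕ< i<k))) (x (fsuc (fromℕ< i<k)))
  step-value S i<k = cong₂ S (step-first i<k) (step-second i<k)

  steps-in-G : Follows (adj G) (λ _ → true) k
  steps-in-G i i<k = trans (step-value (adj G) i<k) (inG _)

  loopless : Loopless k
  loopless = loopless-within k (adj G) (Graph.irrefl G) steps-in-G

  edge-distinct : EdgeDistinct k
  edge-distinct i j i<k j<k i≢j same = [ proj₁ apart , proj₂ apart ] (on-chain same)
    where
      apart = distinct (fromℕ< i<k) (fromℕ< j<k)
                (λ eq → i≢j (trans (sym (toℕ-fromℕ< i<k)) (trans (cong toℕ eq) (toℕ-fromℕ< j<k))))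
      on-chain : SamePair (walk i) (walk (suc i)) (walk j) (walk (suc j)) →
                 SamePair (x (inject₁ (fromℕ< i<k))) (x (fsuc (fromℕ< i<k)))
                          (x (inject₁ (fromℕ< j<k))) (x (fsuc (fromℕ< j<k)))
      on-chain (inj₁ (p , q)) = inj₁ (trans (sym (step-first i<k)) (trans p (step-first j<k)) ,
                                      trans (sym (step-second i<k)) (trans q (step-second j<k)))
      on-chain (inj₂ (p , q)) = inj₂ (trans (sym (step-first i<k)) (trans p (step-second j<k)) ,
                                      trans (sym (step-second i<k)) (trans q (step-first j<k)))

  -- The chain alternates: its odd-numbered edges (even 0-based index) are missing from R.
  follows-R : Follows (adj R) isOdd k
  follows-R i i<k = trans (step-value (adj R) i<k) (by-parity (isOdd i) refl)
    where
      e = fromℕ< i<k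
      parity : toℕ e % 2 ≡ ind (isOdd i)
      parity = trans (cong (_% 2) (toℕ-fromℕ< i<k)) (%2≡isOdd i)
      by-parity : ∀ b → isOdd i ≡ b → adj R (x (inject₁ e)) (x (fsuc e)) ≡ b
      by-parity true  odd  = inR e (trans parity (cong ind odd))
      by-parity false even = notInR e (trans parity (cong ind even))

  R' : Graph n
  R' = toggle R k loopless

  -- The chain has odd length and starts outside R: toggling raises both end degrees.
  degree-R' : ∀ v → deg R' v ≡ deg R v + (visits 0 v + visits k v)
  degree-R' = toggle-odd-degree k R loopless edge-distinct follows-R
                (trans (cong isEven (proj₂ k-odd)) (isEven-oddForm (proj₁ k-odd)))

  first-deg≤1 : deg R (walk 0) ≤ 1
  first-deg≤1 with ends
  ... | inj₁ (_ , d₀ , _) = d₀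
  ... | inj₂ (_ , d₀)     = ≤-trans (≤-reflexive d₀) z≤n

  last-deg≤1 : deg R (walk k) ≤ 1
  last-deg≤1 with ends
  ... | inj₁ (_ , _ , dₖ) = subst (λ w → deg R w ≤ 1) (sym walk-last) dₖ
  ... | inj₂ (closed , d₀) = subst (λ w → deg R w ≤ 1) (trans closed (sym walk-last)) (≤-trans (≤-reflexive d₀) z≤n)

  closed-deg≡0 : walk 0 ≡ walk k → deg R (walk 0) ≡ 0
  closed-deg≡0 closed with ends
  ... | inj₁ (open′ , _) = ⊥-elim (open′ (trans closed walk-last))
  ... | inj₂ (_ , d₀)    = d₀

  -- Toggled edges come from G, and the end conditions keep all degrees ≤ 2.
  factor-R' : Factor02 G R'
  factor-R' = spanning , degree≤2
    where
      spanning : SpanningSubgraph G R'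
      spanning v y edge with adj R v y in r
      ... | true  = proj₁ FR v y r
      ... | false = onTrail-within k (adj G) (Graph.sym G) steps-in-G v y edge
      degree≤2 : ∀ v → deg R' v ≤ 2
      degree≤2 v = subst (_≤ 2) (sym (degree-R' v))
        (raise-ends-≤2 (deg R) (walk 0) (walk k) (proj₂ FR) first-deg≤1 last-deg≤1 closed-deg≡0 v)

  totalDeg-R' : totalDeg R' ≡ totalDeg R + 2
  totalDeg-R' = begin
    ∑ (deg R')                                                  ≡⟨ sum-cong-≗ degree-R' ⟩
    ∑ (λ v → deg R v + (visits 0 v + visits k v))               ≡⟨ ∑-distrib-+ (deg R) _ ⟩
    totalDeg R + ∑ (λ v → visits 0 v + visits k v)              ≡⟨ cong (totalDeg R +_) (∑-distrib-+ (visits 0) (visits k)) ⟩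
    totalDeg R + (∑ (visits 0) + ∑ (visits k))
      ≡⟨ cong (totalDeg R +_) (cong₂ _+_ (∑-point (walk 0)) (∑-point (walk k))) ⟩
    totalDeg R + 2                                              ∎
    where open ≡-Reasoning

chain-augments : ∀ {n} {G R : Graph n} → Factor02 G R → PChain G R →
                 ∃[ R' ] (Factor02 G R' × totalDeg R < totalDeg R')
chain-augments {R = R} FR chain = R' , factor-R' , subst (totalDeg R <_) (sym totalDeg-R') (m<m+n (totalDeg R) (s≤s z≤n))
  where open ChainToggle FR chain

-- Given a [0,2]-factor R' with more edges than R, walk
-- from a vertex where R' has larger degree than R, alternately along added edges (in R',
-- not in R) and removed edges (in R, not in R'), never reusing an edge.  Getting stuck after
-- an added edge means the trail is a P-chain; getting stuck after a removed edge means that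
-- toggling R' along the trail gives a factor of the same size closer to R, and we restart.
module Augment {n : ℕ} {G R : Graph n} (FR : Factor02 G R) where

  added removed differ : Graph n → Fin n → Fin n → Bool
  added   R' v y = adj R' v y ∧ not (adj R v y)
  removed R' v y = adj R v y ∧ not (adj R' v y)
  differ  R' v y = adj R' v y xor adj R v y

  #added #removed : Graph n → Fin n → ℕ
  #added   R' v = ∑ (λ y → ind (added R' v y))
  #removed R' v = ∑ (λ y → ind (removed R' v y))

  -- The number of (ordered) vertex pairs on which R' and R disagree.
  distance : Graph n → ℕ
  distance R' = ∑ (λ v → ∑ (λ y → ind (differ R' v y)))

  degree-balance : ∀ R' v → deg R' v + #removed R' v ≡ deg R v + #added R' v
  degree-balance R' v = begin
      deg R' v + #removed R' v
    ≡⟨ cong (_+ #removed R' v) (deg-∑ R' v) ⟩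
      ∑ (λ y → ind (adj R' v y)) + #removed R' v
    ≡⟨ ∑-distrib-+ (λ y → ind (adj R' v y)) (λ y → ind (removed R' v y)) ⟨
      ∑ (λ y → ind (adj R' v y) + ind (removed R' v y))
    ≡⟨ sum-cong-≗ (λ y → exchange (adj R v y) (adj R' v y)) ⟩
      ∑ (λ y → ind (adj R v y) + ind (added R' v y))
    ≡⟨ ∑-distrib-+ (λ y → ind (adj R v y)) (λ y → ind (added R' v y)) ⟩
      ∑ (λ y → ind (adj R v y)) + #added R' v
    ≡⟨ cong (_+ #added R' v) (deg-∑ R v) ⟨
      deg R v + #added R' v
    ∎
    where
      open ≡-Reasoning
      exchange : ∀ r r′ → ind r′ + ind (r ∧ not r′) ≡ ind r + ind (r′ ∧ not r)
      exchange true  true  = refl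
      exchange true  false = refl
      exchange false true  = refl
      exchange false false = refl

  gains-degree : ∀ R' v → #removed R' v < #added R' v → deg R v < deg R' v
  gains-degree R' v lt = +-cancelʳ-< (#removed R' v) (deg R v) (deg R' v) (begin-strict
    deg R v + #removed R' v   <⟨ +-monoʳ-< (deg R v) lt ⟩
    deg R v + #added R' v     ≡⟨ degree-balance R' v ⟨
    deg R' v + #removed R' v  ∎)
    where open ≤-Reasoning

  loses-degree : ∀ R' v → #added R' v < #removed R' v → deg R' v < deg R v
  loses-degree R' v lt = +-cancelʳ-< (#added R' v) (deg R' v) (deg R v) (begin-strict
    deg R' v + #added R' v    <⟨ +-monoʳ-< (deg R' v) lt ⟩
    deg R' v + #removed R' v  ≡⟨ degree-balance R' v ⟩
    deg R v + #added R' v     ∎)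
    where open ≤-Reasoning

  record AltTrail (R' : Graph n) (s : Fin n) : Set where
    field
      len        : ℕ
      walk       : ℕ → Fin n
      starts     : walk 0 ≡ s
      follows-R  : Trail.Follows walk (adj R) isOdd len
      follows-R' : Trail.Follows walk (adj R') isEven len
      distinct   : Trail.EdgeDistinct walk len

  empty-trail : ∀ {R'} s → AltTrail R' s
  empty-trail s = record
    { len = 0 ; walk = λ _ → s ; starts = refl
    ; follows-R = λ _ () ; follows-R' = λ _ () ; distinct = λ _ _ () }

  module AltTrailFacts {R' : Graph n} {s : Fin n} (t : AltTrail R' s) where
    open AltTrail t public
    open Trail walk public

    steps-differ : Follows (differ R') (λ _ → true) len
    steps-differ i i<len = trans (cong₂ _xor_ (follows-R' i i<len) (follows-R i i<len)) (b-xor-not-b (isEven i))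
      where
        b-xor-not-b : ∀ b → (b xor not b) ≡ true
        b-xor-not-b true  = refl
        b-xor-not-b false = refl

    loopless : Loopless len
    loopless = loopless-within len (differ R') (λ v → cong₂ _xor_ (Graph.irrefl R' v) (Graph.irrefl R v)) steps-differ

    onTrail-differ : ∀ v y → onTrail len v y ≡ true → differ R' v y ≡ true
    onTrail-differ = onTrail-within len (differ R') (λ a b → cong₂ _xor_ (Graph.sym R' a b) (Graph.sym R a b)) steps-differ

    trail-in-R : ∀ v → ∑ (λ y → ind (onTrail len v y ∧ adj R v y)) ≡ incidences len isOdd v
    trail-in-R = count-onTrail-∧ len (adj R) isOdd loopless distinct (Graph.sym R) follows-R

    trail-not-in-R : ∀ v → ∑ (λ y → ind (onTrail len v y ∧ not (adj R v y))) ≡ incidences len isEven v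
    trail-not-in-R v = trans (count-onTrail-∧-not len (adj R) isOdd loopless distinct (Graph.sym R) follows-R v)
                             (incidences-not-odd len v)

    trail-removed≤ : ∀ v → incidences len isOdd v ≤ #removed R' v
    trail-removed≤ v = subst (_≤ #removed R' v) (trail-in-R v) (count-mono removed-edge)
      where
        bool : ∀ a r → (a xor r) ≡ true → r ≡ true → (r ∧ not a) ≡ true
        bool false true _ _ = refl
        removed-edge : ∀ y → (onTrail len v y ∧ adj R v y) ≡ true → removed R' v y ≡ true
        removed-edge y on∧r = bool (adj R' v y) (adj R v y) (onTrail-differ v y (proj₁ (∧-true on∧r))) (proj₂ (∧-true on∧r))

    trail-added≤ : ∀ v → incidences len isEven v ≤ #added R' v
    trail-added≤ v = subst (_≤ #added R' v) (trail-not-in-R v) (count-mono added-edge)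
      where
        bool : ∀ a r → (a xor r) ≡ true → not r ≡ true → (a ∧ not r) ≡ true
        bool true false _ _ = refl
        added-edge : ∀ y → (onTrail len v y ∧ not (adj R v y)) ≡ true → added R' v y ≡ true
        added-edge y on∧¬r = bool (adj R' v y) (adj R v y) (onTrail-differ v y (proj₁ (∧-true on∧¬r))) (proj₂ (∧-true on∧¬r))

    length-bound : len * 2 ≤ distance R'
    length-bound = begin
        len * 2
      ≡⟨ sumBelow-const len 2 ⟨
        sumBelow len (λ _ → 2)
      ≡⟨ sumBelow-cong len _ _ (λ i _ → both-ends i) ⟨
        sumBelow len (λ i → ∑ (λ v → 1 * (visits i v + visits (suc i) v)))
      ≡⟨ ∑-sumBelow len (λ v i → 1 * (visits i v + visits (suc i) v)) ⟨
        ∑ (λ v → incidences len (λ _ → true) v)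
      ≡⟨ sum-cong-≗ (λ v → count-usedBy len (λ _ → true) v loopless distinct) ⟨
        ∑ (λ v → ∑ (λ y → ind (onTrail len v y)))
      ≤⟨ ∑-mono (λ v → count-mono (onTrail-differ v)) ⟩
        distance R'
      ∎
      where
        open ≤-Reasoning
        both-ends : ∀ i → ∑ (λ v → 1 * (visits i v + visits (suc i) v)) ≡ 2
        both-ends i = trans (sum-cong-≗ (λ v → *-identityˡ (visits i v + visits (suc i) v)))
                            (trans (∑-distrib-+ (visits i) (visits (suc i)))
                                   (cong₂ _+_ (∑-point (walk i)) (∑-point (walk (suc i)))))

    end : Fin n
    end = walk len

    end-telescope : incidences len isEven end + ind (isEven len)
                  ≡ incidences len isOdd end + (visits 0 end + ind (isOdd len))
    end-telescope = begin
        incidences len isEven end + ind (isEven len)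
      ≡⟨ cong (incidences len isEven end +_) (once (isEven len)) ⟩
        incidences len isEven end + ind (isEven len) * visits len end
      ≡⟨ alternating-telescope (λ i → visits i end) len ⟩
        incidences len isOdd end + (visits 0 end + ind (isOdd len) * visits len end)
      ≡⟨ cong (λ k → incidences len isOdd end + (visits 0 end + k)) (once (isOdd len)) ⟨
        incidences len isOdd end + (visits 0 end + ind (isOdd len))
      ∎
      where
        open ≡-Reasoning
        once : ∀ b → ind b ≡ ind b * visits len end
        once b = sym (trans (cong (ind b *_) (cong ind (≟ᵇ-refl end))) (*-identityʳ (ind b)))

    unusedAtEnd : (Fin n → Fin n → Bool) → Fin n → Bool
    unusedAtEnd S y = S end y ∧ not (onTrail len end y)

    stuck-removed≤ : (∀ y → removed R' end y ≡ true → onTrail len end y ≡ true) →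
                     #removed R' end ≤ incidences len isOdd end
    stuck-removed≤ stuck = subst (#removed R' end ≤_) (trail-in-R end)
      (count-mono (λ y r → ∧-intro (stuck y r) (proj₁ (∧-true r))))

    stuck-added≤ : (∀ y → added R' end y ≡ true → onTrail len end y ≡ true) →
                   #added R' end ≤ incidences len isEven end
    stuck-added≤ stuck = subst (#added R' end ≤_) (trail-not-in-R end)
      (count-mono (λ y a → ∧-intro (stuck y a) (proj₂ (∧-true a))))

  extend : ∀ {R' s} (t : AltTrail R' s) y → let open AltTrailFacts t in
           adj R end y ≡ isOdd len → adj R' end y ≡ isEven len → onTrail len end y ≡ false → AltTrail R' s
  extend {R'} t y in-R in-R' fresh = record
    { len        = suc len
    ; walk       = snoc walk len y
    ; starts     = trans (snoc-old walk len y z≤n) starts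
    ; follows-R  = follows-snoc walk len y (adj R) isOdd follows-R in-R
    ; follows-R' = follows-snoc walk len y (adj R') isEven follows-R' in-R'
    ; distinct   = distinct-snoc walk len y distinct fresh }
    where open AltTrailFacts t

  chain-if-stuck : ∀ {R' s} → Factor02 G R' → #removed R' s < #added R' s → (t : AltTrail R' s) →
                   let open AltTrailFacts t in isEven len ≡ false →
                   (∀ y → removed R' end y ≡ true → onTrail len end y ≡ true) → PChain G R
  chain-if-stuck {R'} {s} FR' gain t odd stuck = record
    { k        = len
    ; k-odd    = oddForm len odd
    ; x        = λ i → walk (toℕ i)
    ; inG      = λ i → trans (at i (adj G)) (steps-in-G (toℕ i) (toℕ<n i))
    ; notInR   = λ i r → trans (edge-in-R i) (ind≡0 (trans (sym (%2≡isOdd (toℕ i))) r))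
    ; inR      = λ i r → trans (edge-in-R i) (ind≡1 (trans (sym (%2≡isOdd (toℕ i))) r))
    ; distinct = λ i j i≢j → (λ p → apart i j i≢j (inj₁ p)) , (λ p → apart i j i≢j (inj₂ p))
    ; ends     = ends-condition }
    where
      open AltTrailFacts t
      ind≡0 : ∀ {b} → ind b ≡ 0 → b ≡ false
      ind≡0 {false} _ = refl
      ind≡1 : ∀ {b} → ind b ≡ 1 → b ≡ true
      ind≡1 {true} _ = refl

      at : ∀ (i : Fin len) S → S (walk (toℕ (inject₁ i))) (walk (suc (toℕ i))) ≡ S (walk (toℕ i)) (walk (suc (toℕ i)))
      at i S = cong (λ j → S (walk j) (walk (suc (toℕ i)))) (toℕ-inject₁ i)

      edge-in-R : ∀ (i : Fin len) → adj R (walk (toℕ (inject₁ i))) (walk (suc (toℕ i))) ≡ isOdd (toℕ i)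
      edge-in-R i = trans (at i (adj R)) (follows-R (toℕ i) (toℕ<n i))

      steps-in-G : Follows (adj G) (λ _ → true) len
      steps-in-G i i<len with isEven i in parity
      ... | true  = proj₁ FR' _ _ (trans (follows-R' i i<len) parity)
      ... | false = proj₁ FR _ _ (trans (follows-R i i<len) (cong not parity))

      apart : ∀ (i j : Fin len) → i ≢ j →
              ¬ SamePair (walk (toℕ (inject₁ i))) (walk (suc (toℕ i))) (walk (toℕ (inject₁ j))) (walk (suc (toℕ j)))
      apart i j i≢j p = distinct (toℕ i) (toℕ j) (toℕ<n i) (toℕ<n j) (i≢j ∘ toℕ-injective)
        (samePair-subst (cong walk (toℕ-inject₁ i)) refl (cong walk (toℕ-inject₁ j)) refl p)

      -- The trail starts where R' has larger degree than R, so R has degree ≤ 1 there.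
      start-deg≤1 : deg R (walk 0) ≤ 1
      start-deg≤1 = subst (λ w → deg R w ≤ 1) (sym starts) (≤-pred (<-≤-trans (gains-degree R' s gain) (proj₂ FR' s)))

      -- At the end, the removed edges are all on the trail, while the trail holds one more
      -- added edge than removed edges there (two more if the trail is closed).
      end-deg≤1 : deg R end + visits 0 end ≤ 1
      end-deg≤1 = +-cancelʳ-≤ 1 (deg R end + visits 0 end) 1 (+-cancelʳ-≤ O (deg R end + visits 0 end + 1) 2 (begin
          deg R end + visits 0 end + 1 + O      ≡⟨ rearrange (deg R end) (visits 0 end) O ⟩
          deg R end + (O + (visits 0 end + 1))  ≡⟨ cong (deg R end +_) telescope-odd ⟨
          deg R end + (E + 0)                   ≡⟨ cong (deg R end +_) (+-identityʳ E) ⟩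
          deg R end + E                         ≤⟨ +-monoʳ-≤ (deg R end) (trail-added≤ end) ⟩
          deg R end + #added R' end             ≡⟨ degree-balance R' end ⟨
          deg R' end + #removed R' end          ≤⟨ +-mono-≤ (proj₂ FR' end) (stuck-removed≤ stuck) ⟩
          2 + O                                 ∎))
        where
          open ≤-Reasoning
          E = incidences len isEven end
          O = incidences len isOdd end
          telescope-odd : E + 0 ≡ O + (visits 0 end + 1)
          telescope-odd = trans (cong (λ b → E + ind b) (sym odd))
                                (trans end-telescope (cong (λ b → O + (visits 0 end + ind (not b))) odd))
          rearrange : ∀ d v O → d + v + 1 + O ≡ d + (O + (v + 1))
          rearrange = solve-∀

      walk-last : walk (toℕ (fromℕ len)) ≡ end
      walk-last = cong walk (toℕ-fromℕ len)

      ends-condition : (walk 0 ≢ walk (toℕ (fromℕ len)) × deg R (walk 0) ≤ 1 × deg R (walk (toℕ (fromℕ len))) ≤ 1)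
                       ⊎ (walk 0 ≡ walk (toℕ (fromℕ len)) × deg R (walk 0) ≡ 0)
      ends-condition with walk 0 ≟ end
      ... | yes closed = inj₂ (trans closed (sym walk-last) ,
                               n≤0⇒n≡0 (+-cancelʳ-≤ 1 (deg R (walk 0)) 0 closed-bound))
        where
          closed-bound : deg R (walk 0) + 1 ≤ 1
          closed-bound = subst (λ b → deg R (walk 0) + ind b ≤ 1) (≟ᵇ-refl (walk 0))
                           (subst (λ w → deg R w + ind (walk 0 ≟ᵇ w) ≤ 1) (sym closed) end-deg≤1)
      ... | no open′   = inj₁ ((λ closed → open′ (trans closed walk-last)) , start-deg≤1 ,
                               subst (λ w → deg R w ≤ 1) (sym walk-last) (m+n≤o⇒m≤o (deg R end) end-deg≤1))

  record Closer (R' : Graph n) : Set where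
    field
      graph     : Graph n
      factor    : Factor02 G graph
      same-size : totalDeg graph ≡ totalDeg R'
      nearer    : distance graph < distance R'

  toggle-agrees-strict : ∀ a t r → t ≡ true → (a xor r) ≡ true → ind ((a xor t) xor r) < ind (a xor r)
  toggle-agrees-strict true  true false refl _ = s≤s z≤n
  toggle-agrees-strict false true true  refl _ = s≤s z≤n

  toggle-agrees : ∀ a t r → (t ≡ true → (a xor r) ≡ true) → ind ((a xor t) xor r) ≤ ind (a xor r)
  toggle-agrees a false r _    = ≤-reflexive (cong (λ b → ind (b xor r)) (xor-identityʳ a))
  toggle-agrees a true  r diff = <⇒≤ (toggle-agrees-strict a true r refl (diff refl))

  closer-if-stuck : ∀ {R' s} → Factor02 G R' → #removed R' s < #added R' s → (t : AltTrail R' s) →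
                    let open AltTrailFacts t in isEven len ≡ true →
                    (∀ y → added R' end y ≡ true → onTrail len end y ≡ true) → Closer R'
  closer-if-stuck {R'} {s} FR' gain t even stuck = record
    { graph     = R''
    ; factor    = spanning , degree≤2
    ; same-size = ∑-shift (deg R'') (deg R') (walk 0) end degree-R''
    ; nearer    = ∑-mono-< (λ v → ∑-mono (shrinks v)) (walk 0) (∑-mono-< (shrinks (walk 0)) (walk 1) first-step-agrees) }
    where
      open AltTrailFacts t
      E = incidences len isEven end
      O = incidences len isOdd end

      telescope-even : E + 1 ≡ O + (visits 0 end + 0)
      telescope-even = trans (cong (λ b → E + ind b) (sym even))
                             (trans end-telescope (cong (λ b → O + (visits 0 end + ind (not b))) even))

      -- The trail does not return to its start: there R' has more added than removed edges.
      open-trail : walk 0 ≢ end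
      open-trail closed = <⇒≱ gain (begin
          #added R' s        ≡⟨ cong (#added R') (trans (sym starts) closed) ⟩
          #added R' end      ≤⟨ stuck-added≤ stuck ⟩
          E                  ≡⟨ +-cancelʳ-≡ 1 E O (trans telescope-even (cong (λ k → O + (k + 0)) starts-at-end)) ⟩
          O                  ≤⟨ trail-removed≤ end ⟩
          #removed R' end    ≡⟨ cong (#removed R') (trans (sym closed) starts) ⟩
          #removed R' s      ∎)
        where
          open ≤-Reasoning
          starts-at-end : visits 0 end ≡ 1
          starts-at-end = cong ind (trans (cong (_≟ᵇ end) closed) (≟ᵇ-refl end))

      -- So at the end the trail holds one more removed than added edge, and R' loses degree.
      end-loses : deg R' end < deg R end
      end-loses = loses-degree R' end (begin-strict
          #added R' end      ≤⟨ stuck-added≤ stuck ⟩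
          E                  <⟨ m<m+n E (s≤s z≤n) ⟩
          E + 1              ≡⟨ telescope-even ⟩
          O + (visits 0 end + 0)  ≡⟨ cong (λ k → O + (k + 0)) (cong ind (≟ᵇ-≢ open-trail)) ⟩
          O + 0              ≡⟨ +-identityʳ O ⟩
          O                  ≤⟨ trail-removed≤ end ⟩
          #removed R' end    ∎)
        where open ≤-Reasoning

      R'' : Graph n
      R'' = toggle R' len loopless

      degree-R'' : ∀ v → deg R'' v + visits 0 v ≡ deg R' v + visits len v
      degree-R'' = toggle-even-degree len R' loopless distinct follows-R' even

      degree≤2 : ∀ v → deg R'' v ≤ 2
      degree≤2 v with end ≟ v
      ... | yes refl = begin
          deg R'' end                 ≡⟨ +-identityʳ (deg R'' end) ⟨
          deg R'' end + 0             ≡⟨ cong (λ b → deg R'' end + ind b) (≟ᵇ-≢ open-trail) ⟨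
          deg R'' end + visits 0 end  ≡⟨ degree-R'' end ⟩
          deg R' end + visits len end ≡⟨ cong (λ b → deg R' end + ind b) (≟ᵇ-refl end) ⟩
          deg R' end + 1              ≡⟨ +-comm (deg R' end) 1 ⟩
          suc (deg R' end)            ≤⟨ end-loses ⟩
          deg R end                   ≤⟨ proj₂ FR end ⟩
          2                           ∎
        where open ≤-Reasoning
      ... | no end≢v = begin
          deg R'' v                   ≤⟨ m≤m+n (deg R'' v) (visits 0 v) ⟩
          deg R'' v + visits 0 v      ≡⟨ degree-R'' v ⟩
          deg R' v + visits len v     ≡⟨ cong (λ b → deg R' v + ind b) (≟ᵇ-≢ end≢v) ⟩
          deg R' v + 0                ≡⟨ +-identityʳ (deg R' v) ⟩
          deg R' v                    ≤⟨ proj₂ FR' v ⟩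
          2                           ∎
        where open ≤-Reasoning

      -- New edges of R'' are removed edges, hence edges of R.
      spanning : SpanningSubgraph G R''
      spanning v y edge with adj R' v y in a
      ... | true  = proj₁ FR' v y a
      ... | false = proj₁ FR v y (trans (sym (cong (_xor adj R v y) a)) (onTrail-differ v y edge))

      shrinks : ∀ v y → ind (differ R'' v y) ≤ ind (differ R' v y)
      shrinks v y = toggle-agrees (adj R' v y) (onTrail len v y) (adj R v y) (onTrail-differ v y)

      first-step-agrees : ind (differ R'' (walk 0) (walk 1)) < ind (differ R' (walk 0) (walk 1))
      first-step-agrees = toggle-agrees-strict (adj R' (walk 0) (walk 1)) _ (adj R (walk 0) (walk 1))
                            first-step (onTrail-differ (walk 0) (walk 1) first-step)
        where
          nonempty : 0 < len
          nonempty = n≢0⇒n>0 (λ len≡0 → open-trail (cong walk (sym len≡0)))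
          first-step : onTrail len (walk 0) (walk 1) ≡ true
          first-step = anyBelow-intro len _ 0 nonempty
                         (dec-true (samePair? (walk 0) (walk 1) (walk 0) (walk 1)) (inj₁ (refl , refl)))

  extend-added : ∀ {R' s} (t : AltTrail R' s) y → let open AltTrailFacts t in isEven len ≡ true →
                 unusedAtEnd (added R') y ≡ true → AltTrail R' s
  extend-added {R'} t y even next = extend t y
      (trans (not-true (proj₂ in-R'-not-R)) (sym (cong not even)))
      (trans (proj₁ in-R'-not-R) (sym even))
      (not-true (proj₂ added-unused))
    where
      open AltTrailFacts t
      added-unused = ∧-true {added R' end y} next
      in-R'-not-R  = ∧-true {adj R' end y} (proj₁ added-unused)

  extend-removed : ∀ {R' s} (t : AltTrail R' s) y → let open AltTrailFacts t in isEven len ≡ false →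
                   unusedAtEnd (removed R') y ≡ true → AltTrail R' s
  extend-removed {R'} t y odd next = extend t y
      (trans (proj₁ in-R-not-R') (sym (cong not odd)))
      (trans (not-true (proj₂ in-R-not-R')) (sym odd))
      (not-true (proj₂ removed-unused))
    where
      open AltTrailFacts t
      removed-unused = ∧-true {removed R' end y} next
      in-R-not-R'    = ∧-true {adj R end y} (proj₁ removed-unused)

  shift-budget : ∀ {d} len budget → d < (len + suc budget) * 2 → d < (suc len + budget) * 2
  shift-budget {d} len budget = subst (λ k → d < k * 2) (+-suc len budget)

  -- Greedy growth of an alternating trail.  Since its length is bounded by the distance of R'
  -- from R, the budget of remaining steps never runs out.
  grow : ∀ budget {R' s} → Factor02 G R' → #removed R' s < #added R' s → (t : AltTrail R' s) →
         distance R' < (AltTrail.len t + budget) * 2 → PChain G R ⊎ Closer R'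
  grow zero FR' gain t bound =
    ⊥-elim (<⇒≱ (subst (λ k → _ < k * 2) (+-identityʳ len) bound) length-bound)
    where open AltTrailFacts t
  grow (suc budget) {R'} FR' gain t bound with isEven (AltTrail.len t) in parity
  ... | true with search (AltTrailFacts.unusedAtEnd t (added R'))
  ...   | inj₁ (y , next) =
    grow budget FR' gain (extend-added t y parity next) (shift-budget (AltTrail.len t) budget bound)
  ...   | inj₂ stuck      = inj₂ (closer-if-stuck FR' gain t parity (λ y → ∧-not-false (stuck y)))
  grow (suc budget) {R'} FR' gain t bound | false with search (AltTrailFacts.unusedAtEnd t (removed R'))
  ...   | inj₁ (y , next) =
    grow budget FR' gain (extend-removed t y parity next) (shift-budget (AltTrail.len t) budget bound)
  ...   | inj₂ stuck      = inj₁ (chain-if-stuck FR' gain t parity (λ y → ∧-not-false (stuck y)))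

  start-vertex : ∀ {R'} → totalDeg R < totalDeg R' → ∃[ s ] (#removed R' s < #added R' s)
  start-vertex {R'} more with any? (λ v → #removed R' v <? #added R' v)
  ... | yes found = found
  ... | no none   = ⊥-elim (<⇒≱ more (+-cancelʳ-≤ (∑ (#removed R')) (totalDeg R') (totalDeg R) (begin
      totalDeg R' + ∑ (#removed R')          ≡⟨ ∑-distrib-+ (deg R') (#removed R') ⟨
      ∑ (λ v → deg R' v + #removed R' v)     ≡⟨ sum-cong-≗ (degree-balance R') ⟩
      ∑ (λ v → deg R v + #added R' v)        ≡⟨ ∑-distrib-+ (deg R) (#added R') ⟩
      totalDeg R + ∑ (#added R')             ≤⟨ +-monoʳ-≤ (totalDeg R) (∑-mono (λ v → ≮⇒≥ (λ lt → none (v , lt)))) ⟩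
      totalDeg R + ∑ (#removed R')           ∎)))
    where open ≤-Reasoning

  -- Rounds of trail growth, each ending in a P-chain or a strictly closer factor; the budget
  -- bounds the distance of the current factor from R.
  find-chain : ∀ budget R' → distance R' < budget → Factor02 G R' → totalDeg R < totalDeg R' → PChain G R
  find-chain (suc budget) R' near FR' more with start-vertex {R'} more
  ... | s , gain with grow (suc (distance R')) {R'} FR' gain (empty-trail s) (<-≤-trans (n<1+n _) (m≤m*n _ 2))
  ...   | inj₁ chain  = chain
  ...   | inj₂ closer = find-chain budget graph (<-≤-trans nearer (≤-pred near)) factor
                          (subst (totalDeg R <_) (sym same-size) more)
    where open Closer closer

augmenting-chain : ∀ {n} {G R R' : Graph n} → Factor02 G R → Factor02 G R' → totalDeg R < totalDeg R' → PChain G R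
augmenting-chain {G = G} {R} {R'} FR FR' more = find-chain (suc (distance R')) R' ≤-refl FR' more
  where open Augment {G = G} {R} FR

theorem2p2 : (n : ℕ) (G R : Graph n) → Factor02 G R →
    (Maximum G R ⇔ (¬ PChain G R))
theorem2p2 n G R FR = mk⇔ maximum⇒no-chain no-chain⇒maximum
  where
    maximum⇒no-chain : Maximum G R → ¬ PChain G R
    maximum⇒no-chain maximum chain with chain-augments {G = G} {R} FR chain
    ... | R' , FR' , more = <⇒≱ (TS-antitone-strict {G = G} {R} {R'} FR FR' more) (maximum R' FR')

    no-chain⇒maximum : ¬ PChain G R → Maximum G R
    no-chain⇒maximum no-chain R' FR' with totalDeg R' ≤? totalDeg R
    ... | yes fewer = TS-antitone {G = G} {R'} {R} FR' FR fewer
    ... | no more   = ⊥-elim (no-chain (augmenting-chain {G = G} {R} {R'} FR FR' (≰⇒> more)))
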